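{- For all integers $a,b\geq 1$ there exists an $SMR(4b,2b(4a+1);4a+1,2)$.
   Context: A signed magic rectangle $SMR(m,n;r,s)$ is an $m\times n$ array, some of whose cells are filled with integers and the others empty, such that exactly $r$ cells in every row and exactly $s$ cells in every column are filled (so $mr=ns$), every element of $X$ appears exactly once in the array, and the sum of the entries of each row and of each column is zero, where (for $mr$ even) $X=\{\pm1,\pm2,\ldots,\pm mr/2\}$. -}

module Defs where

open import Data.Nat using (ℕ; suc; _*_; _/_; _≤_)
open import Data.Integer as ℤ using (ℤ; +_; ∣_∣; 0ℤ)
open import Data.Fin using (Fin)
open import Data.Maybe using (Maybe; just; nothing; is-just)
open import Data.List using (List; map; sum; length; filter; mapMaybe)
open import Data.List.Base using (allFin)
open import Data.Product using (Σ; _×_; _,_; ∃)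
open import Data.Bool using (true)
open import Relation.Binary.PropositionalEquality using (_≡_)
open import Relation.Nullary using (¬_)

-- A partially filled m × n array of integers: nothing = empty cell.
PArray : ℕ → ℕ → Set
PArray m n = Fin m → Fin n → Maybe ℤ

filled : List (Maybe ℤ) → List ℤ
filled = mapMaybe (λ c → c)

row : ∀ {m n} → PArray m n → Fin m → List (Maybe ℤ)
row {n = n} A i = map (λ j → A i j) (allFin n)

col : ∀ {m n} → PArray m n → Fin n → List (Maybe ℤ)
col {m = m} A j = map (λ i → A i j) (allFin m)

sumℤ : List ℤ → ℤ
sumℤ = Data.List.foldr ℤ._+_ 0ℤ

InX : ℕ → ℤ → Set
InX k x = ¬ (x ≡ 0ℤ) × ∣ x ∣ ≤ k

-- Signed magic rectangle SMR(m,n;r,s) (for m*r even), X = {±1,…,±(m*r/2)}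
record IsSMR (m n r s : ℕ) (A : PArray m n) : Set where
  field
    rowFilled : ∀ i → length (filled (row A i)) ≡ r
    colFilled : ∀ j → length (filled (col A j)) ≡ s
    entriesInX : ∀ i j x → A i j ≡ just x → InX (m * r / 2) x
    eachOnce : ∀ x → InX (m * r / 2) x →
      Σ (Fin m × Fin n) λ { (i , j) → A i j ≡ just x ×
        (∀ i' j' → A i' j' ≡ just x → (i' ≡ i × j' ≡ j)) }
    rowSum : ∀ i → sumℤ (filled (row A i)) ≡ 0ℤ
    colSum : ∀ j → sumℤ (filled (col A j)) ≡ 0ℤ

SMR : ℕ → ℕ → ℕ → ℕ → Set
SMR m n r s = Σ (PArray m n) (IsSMR m n r s)

-- Column j holds j + 1 and −(j + 1) in two different rows, so every column sums to zero and
-- every element of X is used exactly once; only the rows need an argument.  Write the rows as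
-- i = ρ + 4g (ρ < 4, g < b).  The first 10b columns come in ten types of b columns, each meeting
-- every group of four rows once, in the rows given by two offset tables (the first type lists the
-- groups in reverse order).  The entry such a column puts in group g is affine in g and
-- d = b − 1 − g, and evaluating the tables shows that for each ρ the positive and negative
-- entries balance and that there are 5 of them.  The remaining 8(a − 1)b columns form a − 1
-- layers of 2b quadruples v, v + 1, v + 2, v + 3 in rows 2k, 2k + 1 with signs (+, −, −, +) and
-- (−, +, +, −): each quadruple cancels in both rows, and every row meets one quadruple per
-- layer, which brings the row count to 4(a − 1) + 5 = 4a + 1.
module Submission where

open import Defs
open import Data.Fin using (Fin; toℕ; #_)
open import Data.Fin.Properties using (toℕ<n; toℕ-injective)
open import Data.Nat using (ℕ; zero; suc; _+_; _*_; _∸_; _<_; _≤_; z≤n; s≤s; NonZero; >-nonZero; _/_; _%_; _≟_; _<?_)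
open import Data.Nat.DivMod
open import Data.Nat.Properties
open import Algebra.Properties.CommutativeSemigroup +-commutativeSemigroup using (interchange; x∙yz≈y∙xz)
open import Data.Nat.Tactic.RingSolver using (solve-∀)
open import Data.Product using (Σ; _×_; _,_)
open import Function.Base using (_∘_)
open import Relation.Nullary using (Dec; yes; no; contradiction)
open import Relation.Binary.PropositionalEquality

∑ : ℕ → (ℕ → ℕ) → ℕ
∑ zero    f = 0
∑ (suc n) f = f 0 + ∑ n (f ∘ suc)

∑-cong : ∀ n {f g : ℕ → ℕ} → (∀ j → j < n → f j ≡ g j) → ∑ n f ≡ ∑ n g
∑-cong zero    eq = refl
∑-cong (suc n) eq = cong₂ _+_ (eq 0 (s≤s z≤n)) (∑-cong n (λ j j<n → eq (suc j) (s≤s j<n)))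

∑-distrib-+ : ∀ n (f g : ℕ → ℕ) → ∑ n (λ j → f j + g j) ≡ ∑ n f + ∑ n g
∑-distrib-+ zero    f g = refl
∑-distrib-+ (suc n) f g = trans (cong (f 0 + g 0 +_) (∑-distrib-+ n (f ∘ suc) (g ∘ suc)))
                                (interchange (f 0) (g 0) _ _)

∑-distribˡ-* : ∀ n c (f : ℕ → ℕ) → ∑ n (λ j → c * f j) ≡ c * ∑ n f
∑-distribˡ-* zero    c f = sym (*-zeroʳ c)
∑-distribˡ-* (suc n) c f = trans (cong (c * f 0 +_) (∑-distribˡ-* n c (f ∘ suc)))
                                 (sym (*-distribˡ-+ c (f 0) _))

∑-const : ∀ n c → ∑ n (λ _ → c) ≡ n * c
∑-const zero    c = refl
∑-const (suc n) c = cong (c +_) (∑-const n c)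

∑-split : ∀ m n (f : ℕ → ℕ) → ∑ (m + n) f ≡ ∑ m f + ∑ n (λ j → f (m + j))
∑-split zero    n f = refl
∑-split (suc m) n f = trans (cong (f 0 +_) (∑-split m n (f ∘ suc))) (sym (+-assoc (f 0) _ _))

∑-blocks : ∀ k d (f : ℕ → ℕ) → ∑ (k * d) f ≡ ∑ k (λ x → ∑ d (λ h → f (h + x * d)))
∑-blocks zero    d f = refl
∑-blocks (suc k) d f = begin
  ∑ (d + k * d) f                                          ≡⟨ ∑-split d (k * d) f ⟩
  ∑ d f + ∑ (k * d) (λ j → f (d + j))                       ≡⟨ cong₂ _+_ (∑-cong d (λ h _ → cong f (sym (+-identityʳ h))))
                                                                          (∑-blocks k d (λ j → f (d + j))) ⟩
  ∑ d (λ h → f (h + 0)) + ∑ k (λ x → ∑ d (λ h → f (d + (h + x * d))))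
                                                           ≡⟨ cong (∑ d (λ h → f (h + 0)) +_)
                                                                (∑-cong k (λ x _ → ∑-cong d (λ h _ → cong f (x∙yz≈y∙xz d h (x * d))))) ⟩
  ∑ (suc k) (λ x → ∑ d (λ h → f (h + x * d)))               ∎
  where open ≡-Reasoning

∑-distribʳ-* : ∀ n (f : ℕ → ℕ) c → ∑ n (λ j → f j * c) ≡ ∑ n f * c
∑-distribʳ-* n f c = trans (∑-cong n (λ j _ → *-comm (f j) c)) (trans (∑-distribˡ-* n c f) (*-comm c (∑ n f)))

∑-affine : ∀ n (c α β : ℕ → ℕ) u →
  ∑ n (λ x → c x * (α x + β x * u)) ≡ ∑ n (λ x → c x * α x) + ∑ n (λ x → c x * β x) * u
∑-affine n c α β u = begin
  ∑ n (λ x → c x * (α x + β x * u))           ≡⟨ ∑-cong n (λ x _ → distrib (c x) (α x) (β x)) ⟩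
  ∑ n (λ x → c x * α x + c x * β x * u)       ≡⟨ ∑-distrib-+ n _ _ ⟩
  ∑ n (λ x → c x * α x) + ∑ n (λ x → c x * β x * u) ≡⟨ cong (∑ n (λ x → c x * α x) +_) (∑-distribʳ-* n _ u) ⟩
  ∑ n (λ x → c x * α x) + ∑ n (λ x → c x * β x) * u ∎
  where
  open ≡-Reasoning
  distrib : ∀ c a b → c * (a + b * u) ≡ c * a + c * b * u
  distrib c a b = trans (*-distribˡ-+ c a (b * u)) (cong (c * a +_) (sym (*-assoc c b u)))

∑-affine₂ : ∀ n (c α β γ : ℕ → ℕ) u v →
  ∑ n (λ x → c x * (α x + β x * u + γ x * v)) ≡
  ∑ n (λ x → c x * α x) + ∑ n (λ x → c x * β x) * u + ∑ n (λ x → c x * γ x) * v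
∑-affine₂ n c α β γ u v =
  trans (∑-affine n c (λ x → α x + β x * u) γ v) (cong (_+ ∑ n (λ x → c x * γ x) * v) (∑-affine n c α β u))

module _ {d : ℕ} .{{_ : NonZero d}} where

  [m+kn]%n≡m : ∀ {m} k → m < d → (m + k * d) % d ≡ m
  [m+kn]%n≡m {m} k m<d = trans ([m+kn]%n≡m%n m k d) (m<n⇒m%n≡m m<d)

  [m+kn]/n≡k : ∀ {m} k → m < d → (m + k * d) / d ≡ k
  [m+kn]/n≡k {m} k m<d = begin
    (m + k * d) / d     ≡⟨ +-distrib-/ m (k * d) (subst (_< d) (sym m%d+kd%d≡m) m<d) ⟩
    m / d + k * d / d   ≡⟨ cong₂ _+_ (m<n⇒m/n≡0 m<d) (m*n/n≡m k d) ⟩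
    k                   ∎
    where
    open ≡-Reasoning
    m%d+kd%d≡m : m % d + k * d % d ≡ m
    m%d+kd%d≡m = trans (cong₂ _+_ (m<n⇒m%n≡m m<d) (m*n%n≡0 k d)) (+-identityʳ m)

m+n*d<k*d : ∀ {m n d k} → m < d → n < k → m + n * d < k * d
m+n*d<k*d {m} {n} {d} m<d n<k = <-≤-trans (+-monoˡ-< (n * d) m<d) (*-monoˡ-≤ d n<k)

m∸[1+n]<m : ∀ {m n} → n < m → m ∸ suc n < m
m∸[1+n]<m {suc m} {n} _ = s≤s (m∸n≤m m n)

m∸[1+[m∸[1+n]]]≡n : ∀ {m n} → n < m → m ∸ suc (m ∸ suc n) ≡ n
m∸[1+[m∸[1+n]]]≡n {suc m} (s≤s n≤m) = m∸[m∸n]≡n n≤m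

δ : ℕ → ℕ → ℕ
δ zero    zero    = 1
δ zero    (suc _) = 0
δ (suc _) zero    = 0
δ (suc m) (suc n) = δ m n

δ-refl : ∀ m → δ m m ≡ 1
δ-refl zero    = refl
δ-refl (suc m) = δ-refl m

δ-≢ : ∀ {m n} → m ≢ n → δ m n ≡ 0
δ-≢ {zero}  {zero}  m≢n = contradiction refl m≢n
δ-≢ {zero}  {suc n} m≢n = refl
δ-≢ {suc m} {zero}  m≢n = refl
δ-≢ {suc m} {suc n} m≢n = δ-≢ (m≢n ∘ cong suc)

δ-sym : ∀ m n → δ m n ≡ δ n m
δ-sym zero    zero    = refl
δ-sym zero    (suc n) = refl
δ-sym (suc m) zero    = refl
δ-sym (suc m) (suc n) = δ-sym m n

∑-δ-pointˡ : ∀ n {t} (f : ℕ → ℕ) → t < n → ∑ n (λ h → δ t h * f h) ≡ f t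
∑-δ-pointˡ (suc n) {zero}  f _         = begin
  f 0 + 0 + ∑ n (λ _ → 0) ≡⟨ cong₂ _+_ (+-identityʳ (f 0)) (trans (∑-const n 0) (*-zeroʳ n)) ⟩
  f 0 + 0                 ≡⟨ +-identityʳ (f 0) ⟩
  f 0                     ∎
  where open ≡-Reasoning
∑-δ-pointˡ (suc n) {suc t} f (s≤s t<n) = ∑-δ-pointˡ n (f ∘ suc) t<n

∑-δ-pointʳ : ∀ n {t} (f : ℕ → ℕ) → t < n → ∑ n (λ h → δ h t * f h) ≡ f t
∑-δ-pointʳ n {t} f t<n = trans (∑-cong n (λ h _ → cong (_* f h) (δ-sym h t))) (∑-δ-pointˡ n f t<n)

∑-δ : ∀ n {t} → t < n → ∑ n (λ h → δ h t) ≡ 1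
∑-δ n {t} t<n = trans (∑-cong n (λ h _ → sym (*-identityʳ (δ h t)))) (∑-δ-pointʳ n (λ _ → 1) t<n)

δ-involution : ∀ {n} (σ : ℕ → ℕ) → (∀ {x} → x < n → σ (σ x) ≡ x) → ∀ {g h} → g < n → h < n → δ g (σ h) ≡ δ (σ g) h
δ-involution σ invol {g} {h} g<n h<n with g ≟ σ h
... | yes refl = trans (δ-refl (σ h)) (sym (trans (cong (λ x → δ x h) (invol h<n)) (δ-refl h)))
... | no g≢σh  = trans (δ-≢ g≢σh) (sym (δ-≢ (λ σg≡h → g≢σh (trans (sym (invol g<n)) (cong σ σg≡h)))))

δ-digitwise : ∀ {d} .{{_ : NonZero d}} {ρ P} g γ → ρ < d → P < d → δ (ρ + g * d) (P + γ * d) ≡ δ g γ * δ ρ P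
δ-digitwise {d} {ρ} {P} g γ ρ<d P<d with g ≟ γ | ρ ≟ P
... | yes refl | yes refl = trans (δ-refl (ρ + g * d)) (sym (cong₂ _*_ (δ-refl g) (δ-refl ρ)))
... | no g≢γ   | _        = trans (δ-≢ (g≢γ ∘ high)) (cong (_* δ ρ P) (sym (δ-≢ g≢γ)))
  where high : ρ + g * d ≡ P + γ * d → g ≡ γ
        high eq = trans (sym ([m+kn]/n≡k g ρ<d)) (trans (cong (_/ d) eq) ([m+kn]/n≡k γ P<d))
... | yes refl | no ρ≢P   = trans (δ-≢ (ρ≢P ∘ low)) (trans (sym (*-zeroʳ (δ g g))) (cong (δ g g *_) (sym (δ-≢ ρ≢P))))
  where low : ρ + g * d ≡ P + g * d → ρ ≡ P
        low = +-cancelʳ-≡ (g * d) ρ P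

piecewise : ℕ → (ℕ → ℕ) → (ℕ → ℕ) → ℕ → ℕ
piecewise k f g j with j <? k
... | yes _ = f j
... | no  _ = g (j ∸ k)

piecewise-< : ∀ {k} f g {j} → j < k → piecewise k f g j ≡ f j
piecewise-< {k} f g {j} j<k with j <? k
... | yes _   = refl
... | no j≮k  = contradiction j<k j≮k

piecewise-+ : ∀ k f g j → piecewise k f g (k + j) ≡ g j
piecewise-+ k f g j with k + j <? k
... | yes k+j<k = contradiction k+j<k (m+n≮m k j)
... | no _      = cong g (m+n∸m≡n k j)

piecewise-ind : ∀ (R : ℕ → Set) {k f g} → (∀ j → j < k → R (f j)) → (∀ j → R (g j)) →
                ∀ j → R (piecewise k f g j)
piecewise-ind R {k} Rf Rg j with j <? k
... | yes j<k = Rf j j<k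
... | no  _   = Rg (j ∸ k)

piecewise-pointwise : ∀ (R : ℕ → ℕ → Set) {k f f′ g g′} → (∀ j → R (f j) (f′ j)) → (∀ j → R (g j) (g′ j)) →
                      ∀ j → R (piecewise k f g j) (piecewise k f′ g′ j)
piecewise-pointwise R {k} Rf Rg j with j <? k
... | yes _ = Rf j
... | no  _ = Rg (j ∸ k)

blockwise : ∀ d .{{_ : NonZero d}} → (ℕ → ℕ → ℕ) → ℕ → ℕ
blockwise d F j = F (j / d) (j % d)

blockwise-decode : ∀ {d} .{{_ : NonZero d}} (F : ℕ → ℕ → ℕ) {h} x → h < d → blockwise d F (h + x * d) ≡ F x h
blockwise-decode F x h<d = cong₂ F ([m+kn]/n≡k x h<d) ([m+kn]%n≡m x h<d)

-- Arrays with one positive and one negative entry in each column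

rowWeight : (c w : ℕ → ℕ) → ℕ → ℕ → ℕ
rowWeight c w i n = ∑ n (λ j → δ i (c j) * w j)

-- Data.Integer's prefix +_ stays local to this block: in scope, it makes ℕ sections such as (c +_) unparsable.
module _ where
  open import Data.Fin using (fromℕ<)
  open import Data.Fin.Properties using (toℕ-fromℕ<)
  open import Data.Integer as ℤ using (ℤ; +_; -[1+_]; 0ℤ; _-_)
  import Data.Integer.Properties as ℤ
  import Data.Integer.Tactic.RingSolver as ℤ-Solver
  open import Data.List using (List; _∷_; tabulate; length)
  open import Data.List.Properties using (map-tabulate)
  open import Data.Maybe using (Maybe; just; nothing; maybe′; fromMaybe)
  open import Data.Sum using (_⊎_; inj₁; inj₂)

  count : Maybe ℤ → ℕ
  count = maybe′ (λ _ → 1) 0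

  entry : Maybe ℤ → ℤ
  entry = fromMaybe 0ℤ

  length-filled-∷ : ∀ c cs → length (filled (c ∷ cs)) ≡ count c + length (filled cs)
  length-filled-∷ (just _) cs = refl
  length-filled-∷ nothing  cs = refl

  sumℤ-filled-∷ : ∀ c cs → sumℤ (filled (c ∷ cs)) ≡ entry c ℤ.+ sumℤ (filled cs)
  sumℤ-filled-∷ (just _) cs = refl
  sumℤ-filled-∷ nothing  cs = sym (ℤ.+-identityˡ _)

  length-filled-tabulate : ∀ n (F : ℕ → Maybe ℤ) →
    length (filled (tabulate {n = n} (F ∘ toℕ))) ≡ ∑ n (count ∘ F)
  length-filled-tabulate zero    F = refl
  length-filled-tabulate (suc n) F =
    trans (length-filled-∷ (F 0) (tabulate {n = n} ((F ∘ suc) ∘ toℕ)))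
          (cong (_+_ (count (F 0))) (length-filled-tabulate n (F ∘ suc)))

  sumℤ-filled-tabulate : ∀ n (F : ℕ → Maybe ℤ) (u v : ℕ → ℕ) → (∀ j → entry (F j) ≡ + u j - + v j) →
    sumℤ (filled (tabulate {n = n} (F ∘ toℕ))) ≡ + ∑ n u - + ∑ n v
  sumℤ-filled-tabulate zero    F u v eq = refl
  sumℤ-filled-tabulate (suc n) F u v eq = begin
    sumℤ (filled (F 0 ∷ rest))          ≡⟨ sumℤ-filled-∷ (F 0) rest ⟩
    entry (F 0) ℤ.+ sumℤ (filled rest)  ≡⟨ cong₂ ℤ._+_ (eq 0) (sumℤ-filled-tabulate n (F ∘ suc) (u ∘ suc) (v ∘ suc) (eq ∘ suc)) ⟩
    (+ u 0 - + v 0) ℤ.+ (+ U - + V)     ≡⟨ regroup (+ u 0) (+ v 0) (+ U) (+ V) ⟩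
    (+ u 0 ℤ.+ + U) - (+ v 0 ℤ.+ + V)   ≡⟨ cong₂ _-_ (ℤ.pos-+ (u 0) U) (ℤ.pos-+ (v 0) V) ⟨
    + ∑ (suc n) u - + ∑ (suc n) v       ∎
    where
    open ≡-Reasoning
    rest : List (Maybe ℤ)
    rest = tabulate {n = n} ((F ∘ suc) ∘ toℕ)
    U V : ℕ
    U = ∑ n (u ∘ suc)
    V = ∑ n (v ∘ suc)
    regroup : ∀ a b c d → (a - b) ℤ.+ (c - d) ≡ (a ℤ.+ c) - (b ℤ.+ d)
    regroup = ℤ-Solver.solve-∀

  fromCells : ∀ {m n} → (ℕ → ℕ → Maybe ℤ) → PArray m n
  fromCells C i j = C (toℕ i) (toℕ j)

  row-fromCells : ∀ {m n} (C : ℕ → ℕ → Maybe ℤ) (i : Fin m) →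
    row {n = n} (fromCells C) i ≡ tabulate (C (toℕ i) ∘ toℕ)
  row-fromCells C i = map-tabulate (λ j → j) _

  col-fromCells : ∀ {m n} (C : ℕ → ℕ → Maybe ℤ) (j : Fin n) →
    col {m = m} (fromCells C) j ≡ tabulate ((λ i → C i (toℕ j)) ∘ toℕ)
  col-fromCells C j = map-tabulate (λ i → i) _

  place : ∀ {A B : Set} → Dec A → Dec B → ℕ → Maybe ℤ
  place (yes _) _       j = just (+ suc j)
  place (no _)  (yes _) j = just -[1+ j ]
  place (no _)  (no _)  _ = nothing

  module PairArray {m N : ℕ} (p q : ℕ → ℕ)
    (p≢q : ∀ j → p j ≢ q j) (p<m : ∀ j → p j < m) (q<m : ∀ j → q j < m) where

    cell : ℕ → ℕ → Maybe ℤ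
    cell i j = place (i ≟ p j) (i ≟ q j) j

    count-cell : ∀ i j → count (cell i j) ≡ δ i (p j) + δ i (q j)
    count-cell i j with i ≟ p j | i ≟ q j
    ... | yes refl | _        = sym (cong₂ _+_ (δ-refl i) (δ-≢ (p≢q j)))
    ... | no i≢p   | yes refl = sym (cong₂ _+_ (δ-≢ i≢p) (δ-refl i))
    ... | no i≢p   | no i≢q   = sym (cong₂ _+_ (δ-≢ i≢p) (δ-≢ i≢q))

    entry-cell : ∀ i j → entry (cell i j) ≡ + (δ i (p j) * suc j) - + (δ i (q j) * suc j)
    entry-cell i j with i ≟ p j | i ≟ q j
    ... | yes refl | _        = sym (signed (δ-refl i) (δ-≢ (p≢q j)))
      where signed : ∀ {a b n} → a ≡ 1 → b ≡ 0 → + (a * n) - + (b * n) ≡ + n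
            signed {n = n} refl refl = trans (ℤ.+-identityʳ _) (cong +_ (*-identityˡ n))
    ... | no i≢p   | yes refl = sym (signed (δ-≢ i≢p) (δ-refl i))
      where signed : ∀ {a b n} → a ≡ 0 → b ≡ 1 → + (a * n) - + (b * n) ≡ ℤ.- + n
            signed {n = n} refl refl = trans (ℤ.+-identityˡ _) (cong (ℤ.-_ ∘ +_) (*-identityˡ n))
    ... | no i≢p   | no i≢q   = sym (cong₂ (λ a b → + (a * suc j) - + (b * suc j)) (δ-≢ i≢p) (δ-≢ i≢q))

    array : PArray m N
    array = fromCells cell

    cell-just : ∀ {i j x} → cell i j ≡ just x → (i ≡ p j × x ≡ + suc j) ⊎ (i ≡ q j × x ≡ -[1+ j ])
    cell-just {i} {j} eq with i ≟ p j | i ≟ q j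
    cell-just refl | yes i≡p | _       = inj₁ (i≡p , refl)
    cell-just refl | no _    | yes i≡q = inj₂ (i≡q , refl)
    cell-just ()   | no _    | no _

    cell-p : ∀ j → cell (p j) j ≡ just (+ suc j)
    cell-p j with p j ≟ p j
    ... | yes _   = refl
    ... | no p≢p  = contradiction refl p≢p

    cell-q : ∀ j → cell (q j) j ≡ just -[1+ j ]
    cell-q j with q j ≟ p j | q j ≟ q j
    ... | yes q≡p | _       = contradiction (sym q≡p) (p≢q j)
    ... | no _    | yes _   = refl
    ... | no _    | no q≢q  = contradiction refl q≢q

    Located : ℤ → Set
    Located x = Σ (Fin m) λ i → Σ (Fin N) λ j → array i j ≡ just x × (∀ i′ j′ → array i′ j′ ≡ just x → i′ ≡ i × j′ ≡ j)

    located : ∀ {x i₀ j₀} (i₀<m : i₀ < m) (j₀<N : j₀ < N) → cell i₀ j₀ ≡ just x →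
              (∀ {i j} → cell i j ≡ just x → i ≡ i₀ × j ≡ j₀) → Located x
    located {x} i₀<m j₀<N here unique = fromℕ< i₀<m , fromℕ< j₀<N ,
      trans (cong₂ cell (toℕ-fromℕ< i₀<m) (toℕ-fromℕ< j₀<N)) here ,
      λ i′ j′ eq → let i≡ , j≡ = unique eq in
        toℕ-injective (trans i≡ (sym (toℕ-fromℕ< i₀<m))) , toℕ-injective (trans j≡ (sym (toℕ-fromℕ< j₀<N)))

    located⁺ : ∀ {k} → k < N → Located (+ suc k)
    located⁺ {k} k<N = located (p<m k) k<N (cell-p k) unique
      where unique : ∀ {i j} → cell i j ≡ just (+ suc k) → i ≡ p k × j ≡ k
            unique eq with cell-just eq
            ... | inj₁ (i≡p , refl) = i≡p , refl

    located⁻ : ∀ {k} → k < N → Located -[1+ k ]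
    located⁻ {k} k<N = located (q<m k) k<N (cell-q k) unique
      where unique : ∀ {i j} → cell i j ≡ just -[1+ k ] → i ≡ q k × j ≡ k
            unique eq with cell-just eq
            ... | inj₂ (i≡q , refl) = i≡q , refl

    length-row : ∀ i → length (filled (row array i)) ≡
                       rowWeight p (λ _ → 1) (toℕ i) N + rowWeight q (λ _ → 1) (toℕ i) N
    length-row i = begin
      length (filled (row array i))                           ≡⟨ cong (length ∘ filled) (row-fromCells {n = N} cell i) ⟩
      length (filled (tabulate {n = N} (cell (toℕ i) ∘ toℕ)))  ≡⟨ length-filled-tabulate N (cell (toℕ i)) ⟩
      ∑ N (count ∘ cell (toℕ i))                              ≡⟨ ∑-cong N (λ j _ → trans (count-cell (toℕ i) j)
                                                                   (sym (cong₂ _+_ (*-identityʳ (δ (toℕ i) (p j))) (*-identityʳ (δ (toℕ i) (q j)))))) ⟩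
      ∑ N (λ j → δ (toℕ i) (p j) * 1 + δ (toℕ i) (q j) * 1)   ≡⟨ ∑-distrib-+ N _ _ ⟩
      rowWeight p (λ _ → 1) (toℕ i) N + rowWeight q (λ _ → 1) (toℕ i) N ∎
      where open ≡-Reasoning

    length-col : ∀ j → length (filled (col array j)) ≡ 2
    length-col j = begin
      length (filled (col array j))                           ≡⟨ cong (length ∘ filled) (col-fromCells {m = m} cell j) ⟩
      length (filled (tabulate {n = m} ((λ i → cell i (toℕ j)) ∘ toℕ))) ≡⟨ length-filled-tabulate m (λ i → cell i (toℕ j)) ⟩
      ∑ m (λ i → count (cell i (toℕ j)))                      ≡⟨ ∑-cong m (λ i _ → count-cell i (toℕ j)) ⟩
      ∑ m (λ i → δ i (p (toℕ j)) + δ i (q (toℕ j)))           ≡⟨ ∑-distrib-+ m _ _ ⟩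
      ∑ m (λ i → δ i (p (toℕ j))) + ∑ m (λ i → δ i (q (toℕ j))) ≡⟨ cong₂ _+_ (∑-δ m (p<m (toℕ j))) (∑-δ m (q<m (toℕ j))) ⟩
      2                                                       ∎
      where open ≡-Reasoning

    sumℤ-row : ∀ i → sumℤ (filled (row array i)) ≡ + rowWeight p suc (toℕ i) N - + rowWeight q suc (toℕ i) N
    sumℤ-row i = trans (cong (sumℤ ∘ filled) (row-fromCells {n = N} cell i))
                       (sumℤ-filled-tabulate N (cell (toℕ i)) _ _ (entry-cell (toℕ i)))

    sumℤ-col : ∀ j → sumℤ (filled (col array j)) ≡ 0ℤ
    sumℤ-col j = begin
      sumℤ (filled (col array j))                             ≡⟨ cong (sumℤ ∘ filled) (col-fromCells {m = m} cell j) ⟩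
      sumℤ (filled (tabulate {n = m} ((λ i → cell i (toℕ j)) ∘ toℕ)))
                                                              ≡⟨ sumℤ-filled-tabulate m (λ i → cell i (toℕ j)) _ _ (λ i → entry-cell i (toℕ j)) ⟩
      + ∑ m (λ i → δ i (p (toℕ j)) * suc (toℕ j)) - + ∑ m (λ i → δ i (q (toℕ j)) * suc (toℕ j))
                                                              ≡⟨ cong₂ (λ a b → + a - + b) (∑-δ-pointʳ m (λ _ → suc (toℕ j)) (p<m (toℕ j)))
                                                                                          (∑-δ-pointʳ m (λ _ → suc (toℕ j)) (q<m (toℕ j))) ⟩
      + suc (toℕ j) - + suc (toℕ j)                           ≡⟨ ℤ.+-inverseʳ (+ suc (toℕ j)) ⟩
      0ℤ                                                      ∎
      where open ≡-Reasoning

    entry-InX : ∀ {i j x} → cell i j ≡ just x → j < N → InX N x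
    entry-InX eq j<N with cell-just eq
    ... | inj₁ (_ , refl) = (λ ()) , j<N
    ... | inj₂ (_ , refl) = (λ ()) , j<N

    locate : ∀ x → InX N x → Located x
    locate (+ zero)  (x≢0 , _) = contradiction refl x≢0
    locate (+ suc k) (_ , k<N) = located⁺ k<N
    locate -[1+ k ]  (_ , k<N) = located⁻ k<N

    isSMR : ∀ {r} → m * r / 2 ≡ N →
            (∀ i → i < m → rowWeight p (λ _ → 1) i N + rowWeight q (λ _ → 1) i N ≡ r) →
            (∀ i → i < m → rowWeight p suc i N ≡ rowWeight q suc i N) →
            IsSMR m N r 2 array
    isSMR half rowCount rowBalance = record
      { rowFilled  = λ i → trans (length-row i) (rowCount (toℕ i) (toℕ<n i))
      ; colFilled  = length-col
      ; entriesInX = λ i j x eq → subst (λ k → InX k x) (sym half) (entry-InX eq (toℕ<n j))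
      ; eachOnce   = λ x x∈X → let i , j , here , unique = locate x (subst (λ k → InX k x) half x∈X) in
                                (i , j) , here , unique
      ; rowSum     = λ i → trans (sumℤ-row i)
                           (trans (cong (λ w → + w - + rowWeight q suc (toℕ i) N) (rowBalance (toℕ i) (toℕ<n i)))
                                  (ℤ.+-inverseʳ (+ rowWeight q suc (toℕ i) N)))
      ; colSum     = sumℤ-col
      }

-- Column type x < 10 puts its positive and negative entry in the rows offset⁺ x and offset⁻ x of
-- the group of four rows it meets; parity⁺ s and parity⁻ s do the same for position s of a
-- quadruple inside its pair of rows.
offset⁺ offset⁻ : ℕ → Fin 4
offset⁺ 0 = # 0
offset⁺ 1 = # 0
offset⁺ 2 = # 2
offset⁺ 3 = # 3
offset⁺ 4 = # 3
offset⁺ 5 = # 1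
offset⁺ 6 = # 1
offset⁺ 7 = # 3
offset⁺ 8 = # 0
offset⁺ 9 = # 2
offset⁺ _ = # 0
offset⁻ 0 = # 1
offset⁻ 1 = # 2
offset⁻ 2 = # 1
offset⁻ 3 = # 0
offset⁻ 4 = # 2
offset⁻ 5 = # 2
offset⁻ 6 = # 3
offset⁻ 7 = # 0
offset⁻ 8 = # 1
offset⁻ 9 = # 3
offset⁻ _ = # 1

offset⁺≢offset⁻ : ∀ x → offset⁺ x ≢ offset⁻ x
offset⁺≢offset⁻ 0 ()
offset⁺≢offset⁻ 1 ()
offset⁺≢offset⁻ 2 ()
offset⁺≢offset⁻ 3 ()
offset⁺≢offset⁻ 4 ()
offset⁺≢offset⁻ 5 ()
offset⁺≢offset⁻ 6 ()
offset⁺≢offset⁻ 7 ()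
offset⁺≢offset⁻ 8 ()
offset⁺≢offset⁻ 9 ()
offset⁺≢offset⁻ (suc (suc (suc (suc (suc (suc (suc (suc (suc (suc _)))))))))) ()

parity⁺ parity⁻ : ℕ → Fin 2
parity⁺ 1 = # 1
parity⁺ 2 = # 1
parity⁺ _ = # 0
parity⁻ 1 = # 0
parity⁻ 2 = # 0
parity⁻ _ = # 1

parity⁺≢parity⁻ : ∀ s → parity⁺ s ≢ parity⁻ s
parity⁺≢parity⁻ 0 ()
parity⁺≢parity⁻ 1 ()
parity⁺≢parity⁻ 2 ()
parity⁺≢parity⁻ (suc (suc (suc _))) ()

moment : (ℕ → Fin 4) → ℕ → (ℕ → ℕ) → (ℕ → ℕ) → ℕ
moment P ρ f f′ = ∑ 8 (λ x → δ ρ (toℕ (P x)) * f x) + ∑ 2 (λ e → δ ρ (toℕ (P (8 + e))) * f′ e)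

quadMoment : (ℕ → Fin 2) → ℕ → (ℕ → ℕ) → ℕ
quadMoment σ ε f = ∑ 4 (λ s → δ ε (toℕ (σ s)) * f s)

moment-cong : ∀ P ρ {f f′ h h′ : ℕ → ℕ} → (∀ x → x < 8 → f x ≡ h x) → (∀ e → e < 2 → f′ e ≡ h′ e) →
              moment P ρ f f′ ≡ moment P ρ h h′
moment-cong P ρ f≗h f′≗h′ = cong₂ _+_ (∑-cong 8 (λ x x<8 → cong (δ ρ (toℕ (P x)) *_) (f≗h x x<8)))
                                      (∑-cong 2 (λ e e<2 → cong (δ ρ (toℕ (P (8 + e))) *_) (f′≗h′ e e<2)))

quadMoment-cong : ∀ σ ε {f h : ℕ → ℕ} → (∀ s → f s ≡ h s) → quadMoment σ ε f ≡ quadMoment σ ε h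
quadMoment-cong σ ε f≗h = ∑-cong 4 (λ s _ → cong (δ ε (toℕ (σ s)) *_) (f≗h s))

-- Once ρ or ε is a numeral, the moment of a closed weight is a closed numeral: the table facts
-- below are decided by evaluation.
moment-counts : ∀ ρ → ρ < 4 → moment offset⁺ ρ (λ _ → 1) (λ _ → 1) + moment offset⁻ ρ (λ _ → 1) (λ _ → 1) ≡ 5
moment-counts 0 _ = refl
moment-counts 1 _ = refl
moment-counts 2 _ = refl
moment-counts 3 _ = refl
moment-counts (suc (suc (suc (suc _)))) (s≤s (s≤s (s≤s (s≤s ()))))

quadMoment-counts : ∀ ε → ε < 2 → quadMoment parity⁺ ε (λ _ → 1) + quadMoment parity⁻ ε (λ _ → 1) ≡ 4
quadMoment-counts 0 _ = refl
quadMoment-counts 1 _ = refl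
quadMoment-counts (suc (suc _)) (s≤s (s≤s ()))

quadMoment-balanced : ∀ ε → ε < 2 → ∀ v → quadMoment parity⁺ ε (v +_) ≡ quadMoment parity⁻ ε (v +_)
quadMoment-balanced ε ε<2 v = trans (affine parity⁺) (trans (coefficients ε ε<2) (sym (affine parity⁻)))
  where
  affine : ∀ σ → quadMoment σ ε (v +_) ≡ quadMoment σ ε (λ s → s) + quadMoment σ ε (λ _ → 1) * v
  affine σ = trans (∑-cong 4 (λ s _ → cong (δ ε (toℕ (σ s)) *_) (trans (+-comm v s) (cong (s +_) (sym (*-identityˡ v))))))
                   (∑-affine 4 (λ s → δ ε (toℕ (σ s))) (λ s → s) (λ _ → 1) v)
  coefficients : ∀ ε → ε < 2 →
    quadMoment parity⁺ ε (λ s → s) + quadMoment parity⁺ ε (λ _ → 1) * v ≡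
    quadMoment parity⁻ ε (λ s → s) + quadMoment parity⁻ ε (λ _ → 1) * v
  coefficients 0 _ = refl
  coefficients 1 _ = refl
  coefficients (suc (suc _)) (s≤s (s≤s ()))

αᴬ βᴬ γᴬ αᴮ βᴮ γᴮ : ℕ → ℕ
αᴬ zero    = 1
αᴬ (suc x) = suc (suc x)
βᴬ zero    = 1
βᴬ (suc x) = suc x
γᴬ zero    = 0
γᴬ (suc x) = suc (suc x)
αᴮ e = 9 + e
βᴮ _ = 8
γᴮ _ = 10

-- The entry of the column of type x that meets row group g, as an affine function of
-- d = b − 1 − g and g: b − g for x = 0, g + x b + 1 for 0 < x < 8, 8b + 2g + e + 1 for x = 8 + e.
valueᴬ valueᴮ : ℕ → ℕ → ℕ → ℕ
valueᴬ d g x = αᴬ x + βᴬ x * d + γᴬ x * g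
valueᴮ d g e = αᴮ e + βᴮ e * d + γᴮ e * g

moment-balanced : ∀ ρ → ρ < 4 → ∀ d g →
  moment offset⁺ ρ (valueᴬ d g) (valueᴮ d g) ≡ moment offset⁻ ρ (valueᴬ d g) (valueᴮ d g)
moment-balanced ρ ρ<4 d g = trans (affine offset⁺) (trans (coefficients ρ ρ<4) (sym (affine offset⁻)))
  where
  regroup : ∀ a b c a′ b′ c′ d g → a + b * d + c * g + (a′ + b′ * d + c′ * g) ≡ (a + a′) + (b + b′) * d + (c + c′) * g
  regroup = solve-∀
  affine : ∀ P → moment P ρ (valueᴬ d g) (valueᴮ d g) ≡
                 moment P ρ αᴬ αᴮ + moment P ρ βᴬ βᴮ * d + moment P ρ γᴬ γᴮ * g
  affine P = trans (cong₂ _+_ (∑-affine₂ 8 (λ x → δ ρ (toℕ (P x))) αᴬ βᴬ γᴬ d g)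
                              (∑-affine₂ 2 (λ e → δ ρ (toℕ (P (8 + e)))) αᴮ βᴮ γᴮ d g))
                   (regroup (A αᴬ) (A βᴬ) (A γᴬ) (B αᴮ) (B βᴮ) (B γᴮ) d g)
    where
    A B : (ℕ → ℕ) → ℕ
    A f = ∑ 8 (λ x → δ ρ (toℕ (P x)) * f x)
    B f = ∑ 2 (λ e → δ ρ (toℕ (P (8 + e))) * f e)
  coefficients : ∀ ρ → ρ < 4 →
    moment offset⁺ ρ αᴬ αᴮ + moment offset⁺ ρ βᴬ βᴮ * d + moment offset⁺ ρ γᴬ γᴮ * g ≡
    moment offset⁻ ρ αᴬ αᴮ + moment offset⁻ ρ βᴬ βᴮ * d + moment offset⁻ ρ γᴬ γᴮ * g
  coefficients 0 _ = refl
  coefficients 1 _ = refl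
  coefficients 2 _ = refl
  coefficients 3 _ = refl
  coefficients (suc (suc (suc (suc _)))) (s≤s (s≤s (s≤s (s≤s ()))))

module Construction (a b : ℕ) .{{_ : NonZero b}} where

  instance
    2b-nonZero : NonZero (2 * b)
    2b-nonZero = m*n≢0 2 b

  2b*2≡4b : 2 * b * 2 ≡ 4 * b
  2b*2≡4b = trans (*-comm (2 * b) 2) (sym (*-assoc 2 2 b))

  -- The row group met by position h of block x; block 0 lists the groups in reverse order.
  groupᴬ : ℕ → ℕ → ℕ
  groupᴬ zero    h = b ∸ suc h
  groupᴬ (suc _) h = h

  groupᴬ<b : ∀ x {h} → h < b → groupᴬ x h < b
  groupᴬ<b zero    h<b = m∸[1+n]<m h<b
  groupᴬ<b (suc _) h<b = h<b

  groupᴬ-involutive : ∀ x {h} → h < b → groupᴬ x (groupᴬ x h) ≡ h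
  groupᴬ-involutive zero    h<b = m∸[1+[m∸[1+n]]]≡n h<b
  groupᴬ-involutive (suc _) h<b = refl

  rowᴬ rowᴮ : (ℕ → Fin 4) → ℕ → ℕ → ℕ
  rowᴬ P x h = toℕ (P x) + groupᴬ x h * 4
  rowᴮ P x e = toℕ (P (8 + e)) + x * 4

  rowᶜ : (ℕ → Fin 2) → ℕ → ℕ → ℕ
  rowᶜ σ t s = toℕ (σ s) + t % (2 * b) * 2

  rowOf : (ℕ → Fin 4) → (ℕ → Fin 2) → ℕ → ℕ
  rowOf P σ = piecewise (8 * b) (blockwise b (rowᴬ P))
             (piecewise (b * 2) (blockwise 2 (rowᴮ P)) (blockwise 4 (rowᶜ σ)))

  rowOf-ᴬ : ∀ P σ {h} x → h < b → x < 8 → rowOf P σ (h + x * b) ≡ rowᴬ P x h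
  rowOf-ᴬ P σ x h<b x<8 = trans (piecewise-< _ _ (m+n*d<k*d h<b x<8)) (blockwise-decode (rowᴬ P) x h<b)

  rowOf-ᴮ : ∀ P σ {e} x → e < 2 → x < b → rowOf P σ (8 * b + (e + x * 2)) ≡ rowᴮ P x e
  rowOf-ᴮ P σ x e<2 x<b = trans (piecewise-+ (8 * b) _ _ _)
                             (trans (piecewise-< _ _ (m+n*d<k*d e<2 x<b)) (blockwise-decode (rowᴮ P) x e<2))

  rowOf-ᶜ : ∀ P σ {s} t → s < 4 → rowOf P σ (8 * b + (b * 2 + (s + t * 4))) ≡ rowᶜ σ t s
  rowOf-ᶜ P σ t s<4 = trans (piecewise-+ (8 * b) _ _ _)
                         (trans (piecewise-+ (b * 2) _ _ _) (blockwise-decode (rowᶜ σ) t s<4))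

  rowOf<4b : ∀ P σ j → rowOf P σ j < 4 * b
  rowOf<4b P σ = piecewise-ind (_< 4 * b) {8 * b} (λ j _ → boundᴬ (j / b) (m%n<n j b))
                   (piecewise-ind (_< 4 * b) {b * 2} {blockwise 2 (rowᴮ P)}
                      (λ j j<2b → boundᴮ (j % 2) (m<n*o⇒m/o<n j<2b)) (λ j → boundᶜ (j / 4) (j % 4)))
    where
    boundᴬ : ∀ x {h} → h < b → rowᴬ P x h < 4 * b
    boundᴬ x {h} h<b = subst (rowᴬ P x h <_) (*-comm b 4) (m+n*d<k*d (toℕ<n (P x)) (groupᴬ<b x h<b))
    boundᴮ : ∀ e {x} → x < b → rowᴮ P x e < 4 * b
    boundᴮ e {x} x<b = subst (rowᴮ P x e <_) (*-comm b 4) (m+n*d<k*d (toℕ<n (P (8 + e))) x<b)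
    boundᶜ : ∀ t s → rowᶜ σ t s < 4 * b
    boundᶜ t s = subst (rowᶜ σ t s <_) 2b*2≡4b (m+n*d<k*d (toℕ<n (σ s)) (m%n<n t (2 * b)))

  rowOf-≢ : ∀ {P P′ σ σ′} → (∀ x → P x ≢ P′ x) → (∀ s → σ s ≢ σ′ s) → ∀ j → rowOf P σ j ≢ rowOf P′ σ′ j
  rowOf-≢ {P} {P′} {σ} {σ′} P≢P′ σ≢σ′ =
    piecewise-pointwise _≢_ {8 * b} {blockwise b (rowᴬ P)} {blockwise b (rowᴬ P′)} (λ j → offsets-≢ (P≢P′ (j / b)))
      (piecewise-pointwise _≢_ {b * 2} {blockwise 2 (rowᴮ P)} {blockwise 2 (rowᴮ P′)}
        (λ j → offsets-≢ (P≢P′ (8 + j % 2))) (λ j → offsets-≢ (σ≢σ′ (j % 4))))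
    where
    offsets-≢ : ∀ {k} {o o′ : Fin k} {n} → o ≢ o′ → toℕ o + n ≢ toℕ o′ + n
    offsets-≢ {n = n} o≢o′ eq = o≢o′ (toℕ-injective (+-cancelʳ-≡ n _ _ eq))

  N : ℕ
  N = 2 * b * (4 * suc a + 1)

  N-segments : N ≡ 8 * b + (b * 2 + a * (2 * b) * 4)
  N-segments = lemma a b
    where lemma : ∀ a b → 2 * b * (4 * suc a + 1) ≡ 8 * b + (b * 2 + a * (2 * b) * 4)
          lemma = solve-∀

  rowWeight-segments : ∀ c w i → rowWeight c w i N ≡
    ∑ (8 * b) (λ j → δ i (c j) * w j) +
    ∑ (b * 2) (λ y → δ i (c (8 * b + y)) * w (8 * b + y)) +
    ∑ (a * (2 * b) * 4) (λ y → δ i (c (8 * b + (b * 2 + y))) * w (8 * b + (b * 2 + y)))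
  rowWeight-segments c w i = begin
    rowWeight c w i N                                          ≡⟨ cong (rowWeight c w i) N-segments ⟩
    ∑ (8 * b + (b * 2 + a * (2 * b) * 4)) F                    ≡⟨ ∑-split (8 * b) _ F ⟩
    ∑ (8 * b) F + ∑ (b * 2 + a * (2 * b) * 4) F′               ≡⟨ cong (∑ (8 * b) F +_) (∑-split (b * 2) _ F′) ⟩
    ∑ (8 * b) F + (∑ (b * 2) F′ + ∑ (a * (2 * b) * 4) F″)      ≡⟨ +-assoc (∑ (8 * b) F) _ _ ⟨
    ∑ (8 * b) F + ∑ (b * 2) F′ + ∑ (a * (2 * b) * 4) F″        ∎
    where
    open ≡-Reasoning
    F F′ F″ : ℕ → ℕ
    F j  = δ i (c j) * w j
    F′ y = F (8 * b + y)
    F″ y = F′ (b * 2 + y)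

  weightᴬ : ∀ (P : ℕ → Fin 4) (σ : ℕ → Fin 2) (w : ℕ → ℕ) {i g ρ : ℕ} → i ≡ ρ + g * 4 → g < b → ρ < 4 →
    ∑ (8 * b) (λ j → δ i (rowOf P σ j) * w j) ≡ ∑ 8 (λ x → δ ρ (toℕ (P x)) * w (groupᴬ x g + x * b))
  weightᴬ P σ w {g = g} {ρ} refl g<b ρ<4 = begin
    ∑ (8 * b) F                             ≡⟨ ∑-blocks 8 b F ⟩
    ∑ 8 (λ x → ∑ b (λ h → F (h + x * b)))   ≡⟨ ∑-cong 8 (λ x x<8 → trans (∑-cong b (term x x<8))
                                                                      (∑-δ-pointˡ b (λ h → δ ρ (toℕ (P x)) * w (h + x * b)) (groupᴬ<b x g<b))) ⟩
    ∑ 8 (λ x → δ ρ (toℕ (P x)) * w (groupᴬ x g + x * b)) ∎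
    where
    open ≡-Reasoning
    F : ℕ → ℕ
    F j = δ (ρ + g * 4) (rowOf P σ j) * w j
    term : ∀ x → x < 8 → ∀ h → h < b → F (h + x * b) ≡ δ (groupᴬ x g) h * (δ ρ (toℕ (P x)) * w (h + x * b))
    term x x<8 h h<b = begin
      δ (ρ + g * 4) (rowOf P σ (h + x * b)) * W           ≡⟨ cong (λ r → δ (ρ + g * 4) r * W) (rowOf-ᴬ P σ x h<b x<8) ⟩
      δ (ρ + g * 4) (toℕ (P x) + groupᴬ x h * 4) * W      ≡⟨ cong (_* W) (δ-digitwise g (groupᴬ x h) ρ<4 (toℕ<n (P x))) ⟩
      δ g (groupᴬ x h) * δ ρ (toℕ (P x)) * W              ≡⟨ cong (λ z → z * δ ρ (toℕ (P x)) * W)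
                                                               (δ-involution (groupᴬ x) (groupᴬ-involutive x) g<b h<b) ⟩
      δ (groupᴬ x g) h * δ ρ (toℕ (P x)) * W              ≡⟨ *-assoc (δ (groupᴬ x g) h) _ W ⟩
      δ (groupᴬ x g) h * (δ ρ (toℕ (P x)) * W)            ∎
      where W : ℕ
            W = w (h + x * b)

  weightᴮ : ∀ (P : ℕ → Fin 4) (σ : ℕ → Fin 2) (w : ℕ → ℕ) {i g ρ : ℕ} → i ≡ ρ + g * 4 → g < b → ρ < 4 →
    ∑ (b * 2) (λ y → δ i (rowOf P σ (8 * b + y)) * w (8 * b + y)) ≡
    ∑ 2 (λ e → δ ρ (toℕ (P (8 + e))) * w (8 * b + (e + g * 2)))
  weightᴮ P σ w {g = g} {ρ} refl g<b ρ<4 = begin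
    ∑ (b * 2) F                                  ≡⟨ ∑-blocks b 2 F ⟩
    ∑ b (λ x → ∑ 2 (λ e → F (e + x * 2)))        ≡⟨ ∑-cong b (λ x x<b → trans (∑-cong 2 (term x x<b)) (∑-distribˡ-* 2 (δ g x) (G x))) ⟩
    ∑ b (λ x → δ g x * ∑ 2 (G x))                 ≡⟨ ∑-δ-pointˡ b (λ x → ∑ 2 (G x)) g<b ⟩
    ∑ 2 (G g)                                     ∎
    where
    open ≡-Reasoning
    F : ℕ → ℕ
    F y = δ (ρ + g * 4) (rowOf P σ (8 * b + y)) * w (8 * b + y)
    G : ℕ → ℕ → ℕ
    G x e = δ ρ (toℕ (P (8 + e))) * w (8 * b + (e + x * 2))
    term : ∀ x → x < b → ∀ e → e < 2 → F (e + x * 2) ≡ δ g x * G x e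
    term x x<b e e<2 = begin
      δ (ρ + g * 4) (rowOf P σ (8 * b + (e + x * 2))) * W  ≡⟨ cong (λ r → δ (ρ + g * 4) r * W) (rowOf-ᴮ P σ x e<2 x<b) ⟩
      δ (ρ + g * 4) (toℕ (P (8 + e)) + x * 4) * W          ≡⟨ cong (_* W) (δ-digitwise g x ρ<4 (toℕ<n (P (8 + e)))) ⟩
      δ g x * δ ρ (toℕ (P (8 + e))) * W                    ≡⟨ *-assoc (δ g x) _ W ⟩
      δ g x * G x e                                         ∎
      where W : ℕ
            W = w (8 * b + (e + x * 2))

  weightᶜ : ∀ (P : ℕ → Fin 4) (σ : ℕ → Fin 2) (w : ℕ → ℕ) {i π ε : ℕ} → i ≡ ε + π * 2 → π < 2 * b → ε < 2 →
    ∑ (a * (2 * b) * 4) (λ y → δ i (rowOf P σ (8 * b + (b * 2 + y))) * w (8 * b + (b * 2 + y))) ≡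
    ∑ a (λ u → quadMoment σ ε (λ s → w (8 * b + (b * 2 + (s + (π + u * (2 * b)) * 4)))))
  weightᶜ P σ w {π = π} {ε} refl π<2b ε<2 = begin
    ∑ (a * (2 * b) * 4) F                                        ≡⟨ ∑-blocks (a * (2 * b)) 4 F ⟩
    ∑ (a * (2 * b)) (λ t → ∑ 4 (λ s → F (s + t * 4)))            ≡⟨ ∑-blocks a (2 * b) (λ t → ∑ 4 (λ s → F (s + t * 4))) ⟩
    ∑ a (λ u → ∑ (2 * b) (λ k → ∑ 4 (λ s → F (s + (k + u * (2 * b)) * 4))))
                                                                  ≡⟨ ∑-cong a (λ u _ → ∑-cong (2 * b) (λ k k<2b →
                                                                       trans (∑-cong 4 (term u k k<2b)) (∑-distribˡ-* 4 (δ π k) (G u k)))) ⟩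
    ∑ a (λ u → ∑ (2 * b) (λ k → δ π k * ∑ 4 (G u k)))            ≡⟨ ∑-cong a (λ u _ → ∑-δ-pointˡ (2 * b) (λ k → ∑ 4 (G u k)) π<2b) ⟩
    ∑ a (λ u → ∑ 4 (G u π))                                      ∎
    where
    open ≡-Reasoning
    F : ℕ → ℕ
    F y = δ (ε + π * 2) (rowOf P σ (8 * b + (b * 2 + y))) * w (8 * b + (b * 2 + y))
    G : ℕ → ℕ → ℕ → ℕ
    G u k s = δ ε (toℕ (σ s)) * w (8 * b + (b * 2 + (s + (k + u * (2 * b)) * 4)))
    term : ∀ u k → k < 2 * b → ∀ s → s < 4 → F (s + (k + u * (2 * b)) * 4) ≡ δ π k * G u k s
    term u k k<2b s s<4 = begin
      δ (ε + π * 2) (rowOf P σ (8 * b + (b * 2 + (s + t * 4)))) * W ≡⟨ cong (λ r → δ (ε + π * 2) r * W) (rowOf-ᶜ P σ t s<4) ⟩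
      δ (ε + π * 2) (toℕ (σ s) + t % (2 * b) * 2) * W            ≡⟨ cong (λ r → δ (ε + π * 2) (toℕ (σ s) + r * 2) * W) ([m+kn]%n≡m u k<2b) ⟩
      δ (ε + π * 2) (toℕ (σ s) + k * 2) * W                      ≡⟨ cong (_* W) (δ-digitwise π k ε<2 (toℕ<n (σ s))) ⟩
      δ π k * δ ε (toℕ (σ s)) * W                                ≡⟨ *-assoc (δ π k) _ W ⟩
      δ π k * G u k s                                            ∎
      where t W : ℕ
            t = k + u * (2 * b)
            W = w (8 * b + (b * 2 + (s + t * 4)))

  rowWeight-rowOf : ∀ (P : ℕ → Fin 4) (σ : ℕ → Fin 2) w i → i < 4 * b →
    rowWeight (rowOf P σ) w i N ≡
    moment P (i % 4) (λ x → w (groupᴬ x (i / 4) + x * b)) (λ e → w (8 * b + (e + i / 4 * 2))) +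
    ∑ a (λ u → quadMoment σ (i % 2) (λ s → w (8 * b + (b * 2 + (s + (i / 2 + u * (2 * b)) * 4)))))
  rowWeight-rowOf P σ w i i<4b =
    trans (rowWeight-segments (rowOf P σ) w i)
          (cong₂ _+_ (cong₂ _+_ (weightᴬ P σ w (m≡m%n+[m/n]*n i 4) i/4<b (m%n<n i 4))
                                (weightᴮ P σ w (m≡m%n+[m/n]*n i 4) i/4<b (m%n<n i 4)))
                     (weightᶜ P σ w (m≡m%n+[m/n]*n i 2) i/2<2b (m%n<n i 2)))
    where
    i/4<b : i / 4 < b
    i/4<b = m<n*o⇒m/o<n (subst (i <_) (*-comm 4 b) i<4b)
    i/2<2b : i / 2 < 2 * b
    i/2<2b = m<n*o⇒m/o<n (subst (i <_) (sym 2b*2≡4b) i<4b)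

  plusRow minusRow : ℕ → ℕ
  plusRow  = rowOf offset⁺ parity⁺
  minusRow = rowOf offset⁻ parity⁻

  rowCount : ∀ i → i < 4 * b → rowWeight plusRow (λ _ → 1) i N + rowWeight minusRow (λ _ → 1) i N ≡ 4 * suc a + 1
  rowCount i i<4b = begin
    rowWeight plusRow (λ _ → 1) i N + rowWeight minusRow (λ _ → 1) i N
      ≡⟨ cong₂ _+_ (rowWeight-rowOf offset⁺ parity⁺ (λ _ → 1) i i<4b) (rowWeight-rowOf offset⁻ parity⁻ (λ _ → 1) i i<4b) ⟩
    (M⁺ + ∑ a (λ _ → Q⁺)) + (M⁻ + ∑ a (λ _ → Q⁻))
      ≡⟨ cong₂ _+_ (cong (M⁺ +_) (∑-const a Q⁺)) (cong (M⁻ +_) (∑-const a Q⁻)) ⟩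
    (M⁺ + a * Q⁺) + (M⁻ + a * Q⁻)
      ≡⟨ regroup M⁺ Q⁺ M⁻ Q⁻ a ⟩
    (M⁺ + M⁻) + a * (Q⁺ + Q⁻)
      ≡⟨ cong₂ (λ m q → m + a * q) (moment-counts (i % 4) (m%n<n i 4)) (quadMoment-counts (i % 2) (m%n<n i 2)) ⟩
    5 + a * 4
      ≡⟨ total a ⟩
    4 * suc a + 1
      ∎
    where
    open ≡-Reasoning
    M⁺ M⁻ Q⁺ Q⁻ : ℕ
    M⁺ = moment offset⁺ (i % 4) (λ _ → 1) (λ _ → 1)
    M⁻ = moment offset⁻ (i % 4) (λ _ → 1) (λ _ → 1)
    Q⁺ = quadMoment parity⁺ (i % 2) (λ _ → 1)
    Q⁻ = quadMoment parity⁻ (i % 2) (λ _ → 1)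
    regroup : ∀ m q m′ q′ a → (m + a * q) + (m′ + a * q′) ≡ (m + m′) + a * (q + q′)
    regroup = solve-∀
    total : ∀ a → 5 + a * 4 ≡ 4 * suc a + 1
    total = solve-∀

  rowBalance : ∀ i → i < 4 * b → rowWeight plusRow suc i N ≡ rowWeight minusRow suc i N
  rowBalance i i<4b = begin
    rowWeight plusRow suc i N                                ≡⟨ rowWeight-rowOf offset⁺ parity⁺ suc i i<4b ⟩
    moment offset⁺ (i % 4) Vᴬ Vᴮ + ∑ a (Vᶜ parity⁺)         ≡⟨ cong₂ _+_ balancedᴬᴮ (∑-cong a (λ u _ → balancedᶜ u)) ⟩
    moment offset⁻ (i % 4) Vᴬ Vᴮ + ∑ a (Vᶜ parity⁻)         ≡⟨ rowWeight-rowOf offset⁻ parity⁻ suc i i<4b ⟨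
    rowWeight minusRow suc i N                               ∎
    where
    open ≡-Reasoning
    g d : ℕ
    g = i / 4
    d = b ∸ suc g
    Vᴬ Vᴮ : ℕ → ℕ
    Vᴬ x = suc (groupᴬ x g + x * b)
    Vᴮ e = suc (8 * b + (e + g * 2))
    Vᶜ : (ℕ → Fin 2) → ℕ → ℕ
    Vᶜ σ u = quadMoment σ (i % 2) (λ s → suc (8 * b + (b * 2 + (s + (i / 2 + u * (2 * b)) * 4))))
    b≡ : suc (d + g) ≡ b
    b≡ = trans (sym (+-suc d g)) (m∸n+n≡m (m<n*o⇒m/o<n (subst (i <_) (*-comm 4 b) i<4b)))
    valueᴬ-eq : ∀ x → x < 8 → Vᴬ x ≡ valueᴬ d g x
    valueᴬ-eq zero    _ = lemma₀ d g
      where lemma₀ : ∀ d g → suc (d + 0) ≡ 1 + 1 * d + 0 * g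
            lemma₀ = solve-∀
    valueᴬ-eq (suc x) _ = subst (λ b → suc (g + suc x * b) ≡ valueᴬ d g (suc x)) b≡ (lemma x d g)
      where lemma : ∀ x d g → suc (g + suc x * suc (d + g)) ≡ suc (suc x) + suc x * d + suc (suc x) * g
            lemma = solve-∀
    valueᴮ-eq : ∀ e → e < 2 → Vᴮ e ≡ valueᴮ d g e
    valueᴮ-eq e _ = subst (λ b → suc (8 * b + (e + g * 2)) ≡ valueᴮ d g e) b≡ (lemma e d g)
      where lemma : ∀ e d g → suc (8 * suc (d + g) + (e + g * 2)) ≡ 9 + e + 8 * d + 10 * g
            lemma = solve-∀
    balancedᴬᴮ : moment offset⁺ (i % 4) Vᴬ Vᴮ ≡ moment offset⁻ (i % 4) Vᴬ Vᴮ
    balancedᴬᴮ = trans (moment-cong offset⁺ (i % 4) valueᴬ-eq valueᴮ-eq)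
                (trans (moment-balanced (i % 4) (m%n<n i 4) d g)
                       (sym (moment-cong offset⁻ (i % 4) valueᴬ-eq valueᴮ-eq)))
    balancedᶜ : ∀ u → Vᶜ parity⁺ u ≡ Vᶜ parity⁻ u
    balancedᶜ u = trans (quadMoment-cong parity⁺ (i % 2) shift)
                 (trans (quadMoment-balanced (i % 2) (m%n<n i 2) _)
                        (sym (quadMoment-cong parity⁻ (i % 2) shift)))
      where
      shift : ∀ s → suc (8 * b + (b * 2 + (s + (i / 2 + u * (2 * b)) * 4))) ≡ suc (8 * b + (b * 2 + (i / 2 + u * (2 * b)) * 4)) + s
      shift s = lemma (8 * b) (b * 2) s ((i / 2 + u * (2 * b)) * 4)
        where lemma : ∀ x y s t → suc (x + (y + (s + t))) ≡ suc (x + (y + t)) + s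
              lemma = solve-∀

  module Array = PairArray {4 * b} {N} plusRow minusRow
    (rowOf-≢ offset⁺≢offset⁻ parity⁺≢parity⁻) (rowOf<4b offset⁺ parity⁺) (rowOf<4b offset⁻ parity⁻)

  smr : SMR (4 * b) N (4 * suc a + 1) 2
  smr = Array.array , Array.isSMR half rowCount rowBalance
    where
    half : 4 * b * (4 * suc a + 1) / 2 ≡ N
    half = trans (cong (_/ 2) (lemma a b)) (m*n/n≡m N 2)
      where lemma : ∀ a b → 4 * b * (4 * suc a + 1) ≡ 2 * b * (4 * suc a + 1) * 2
            lemma = solve-∀

lemma13 : ∀ (a b : ℕ) → 1 ≤ a → 1 ≤ b →
    SMR (4 * b) (2 * b * (4 * a + 1)) (4 * a + 1) 2
lemma13 (suc a) b _ 1≤b = Construction.smr a b {{>-nonZero 1≤b}}
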